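{- Stutter-equivalence of teams satisfies: (1) if $T$ is a stutter-free team, then $T=T[f]$ for every stuttering function $f$ of $T$; (2) every team $T$ has a unique stutter-free team that is stutter-equivalent to it; (3) stutter-equivalence of teams is reflexive, symmetric and transitive; (4) every stutter-equivalence class of teams contains exactly one stutter-free team.
   Context: A trace is an infinite sequence $t=t(0)t(1)\cdots$ of sets of propositions; a team is a set of traces. A stuttering function of a trace $t$ is a strictly increasing $f:\mathbb N\to\mathbb N$ with $f(0)=0$ and $t(f(k))=\cdots=t(f(k+1)-1)$ for all $k$; a stuttering function of a team $T$ is a function that is a stuttering function of each $t\in T$. For $f:\mathbb N\to\mathbb N$, $t[f]=t(f(0))t(f(1))\cdots$ and $T[f]=\{t[f]\mid t\in T\}$. Teams $T,T'$ are stutter-equivalent ($T\equiv_{\mathrm{st}}T'$) if there are stuttering functions $f$ of $T$ and $f'$ of $T'$ with $T[f]=T'[f']$. A team $T$ has a stuttering position $i$ if $t(i)=t(i+1)$ for all $t\in T$ but there exist $t\in T$ and $j>i+1$ with $t(i)\ne t(j)$. A team with no stuttering positions is stutter-free. -}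

module Defs where

open import Level using (0ℓ)
open import Data.Nat using (ℕ; zero; suc; _≤_; _<_)
open import Data.Product using (Σ; ∃; ∃-syntax; _×_; _,_)
open import Relation.Binary.PropositionalEquality using (_≡_)
open import Relation.Nullary using (¬_)

-- Everything is parametrised by an alphabet A; in the paper A is the
-- powerset 2^AP of the set of atomic propositions (a "letter" = set of props).
module _ (A : Set) where

  Trace : Set
  Trace = ℕ → A

  _≈_ : Trace → Trace → Set
  t ≈ u = ∀ n → t n ≡ u n

  Team : Set₁
  Team = Trace → Set

  _≐_ : Team → Team → Set
  T ≐ U = (∀ t → T t → ∃[ u ] (U u × t ≈ u))
        × (∀ u → U u → ∃[ t ] (T t × u ≈ t))

  _[_]ᵗ : Trace → (ℕ → ℕ) → Trace
  (t [ f ]ᵗ) n = t (f n)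

  _[_] : Team → (ℕ → ℕ) → Team
  (T [ f ]) u = ∃[ t ] (T t × u ≈ (t [ f ]ᵗ))

  StrictlyIncreasing : (ℕ → ℕ) → Set
  StrictlyIncreasing f = ∀ m n → m < n → f m < f n

  IsStutteringFunction : Trace → (ℕ → ℕ) → Set
  IsStutteringFunction t f =
    StrictlyIncreasing f × f 0 ≡ 0 ×
    (∀ k i → f k ≤ i → i < f (suc k) → t i ≡ t (f k))

  IsTeamStutteringFunction : Team → (ℕ → ℕ) → Set
  IsTeamStutteringFunction T f = ∀ t → T t → IsStutteringFunction t f

  _≡st_ : Team → Team → Set
  T ≡st T' = ∃[ f ] ∃[ f' ] (IsTeamStutteringFunction T f
                           × IsTeamStutteringFunction T' f'
                           × (T [ f ]) ≐ (T' [ f' ]))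

  StutteringPosition : Team → ℕ → Set
  StutteringPosition T i =
    (∀ t → T t → t i ≡ t (suc i))
    × ∃[ t ] ∃[ j ] (T t × suc i < j × ¬ (t i ≡ t j))

  StutterFree : Team → Set
  StutterFree T = ∀ i → ¬ StutteringPosition T i

-- A stuttering function f of a team W only collapses blocks of positions on
-- which every trace of W is constant, so W[f] is a reduct of W.  With excluded
-- middle every team has a stutter-free reduct: jump each time to the next
-- position at which some trace changes.  The heart of the matter is that
-- stutter-free reducts are unique.  If a and b are stuttering functions of W
-- and m is the first index with a (m+1) ≠ b (m+1), say a (m+1) < b (m+1), then
-- b forces every trace to agree at a m and a (m+1); so position m of W[a] is a
-- stall, and if W[a] is stutter-free every trace is constant from a m on.
-- Either way t ∘ a = t ∘ b for every trace t of W.  Part (1) is the case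
-- a = id, and transitivity holds because stutter-equivalent teams have a
-- common stutter-free reduct.
module Submission where

open import Defs
open import Level using (0ℓ)
open import Axiom.ExcludedMiddle using (ExcludedMiddle)
open import Data.Nat using (ℕ; zero; suc; _≤_; _<_; z≤n; _≟_)
open import Data.Nat.Properties
open import Data.Product using (∃; ∃-syntax; _×_; _,_; proj₁; proj₂)
open import Data.Sum using (_⊎_; inj₁; inj₂)
open import Data.Empty using (⊥-elim)
open import Function using (id; _∘_)
open import Relation.Nullary using (¬_; yes; no)
open import Relation.Binary using (tri<; tri≈; tri>)
open import Relation.Binary.PropositionalEquality
  using (_≡_; _≢_; refl; sym; trans; cong; subst)

inc-by-steps : ∀ {f : ℕ → ℕ} → (∀ n → f n < f (suc n)) → ∀ m n → m < n → f m < f n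
inc-by-steps step m (suc n) m<1+n with m≤n⇒m<n∨m≡n (m<1+n⇒m≤n m<1+n)
... | inj₁ m<n  = <-trans (inc-by-steps step m n m<n) (step n)
... | inj₂ refl = step n

module _ {f : ℕ → ℕ} (f-inc : ∀ m n → m < n → f m < f n) where

  inc-mono-≤ : ∀ {m n} → m ≤ n → f m ≤ f n
  inc-mono-≤ {m} {n} m≤n with m≤n⇒m<n∨m≡n m≤n
  ... | inj₁ m<n  = <⇒≤ (f-inc m n m<n)
  ... | inj₂ refl = ≤-refl

  inc-cancel-< : ∀ {m n} → f m < f n → m < n
  inc-cancel-< fm<fn = ≰⇒> (λ n≤m → <⇒≱ fm<fn (inc-mono-≤ n≤m))

  inc-inflationary : ∀ n → n ≤ f n
  inc-inflationary zero    = z≤n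
  inc-inflationary (suc n) = ≤-<-trans (inc-inflationary n) (f-inc n (suc n) (n<1+n n))

  inc-block : f 0 ≡ 0 → ∀ i → ∃[ j ] (f j ≤ i × i < f (suc j))
  inc-block f0≡0 zero =
    0 , subst (_≤ 0) (sym f0≡0) ≤-refl , subst (_< f 1) f0≡0 (f-inc 0 1 (n<1+n 0))
  inc-block f0≡0 (suc i) with inc-block f0≡0 i
  ... | j , fj≤i , i<fj+1 with m≤n⇒m<n∨m≡n i<fj+1
  ...   | inj₁ 1+i<fj+1 = j , m≤n⇒m≤1+n fj≤i , 1+i<fj+1
  ...   | inj₂ 1+i≡fj+1 =
    suc j , subst (_≤ suc i) 1+i≡fj+1 ≤-refl
          , subst (_< f (suc (suc j))) (sym 1+i≡fj+1) (f-inc (suc j) (suc (suc j)) (n<1+n _))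

module _ (A : Set) where

  private
    infix 4 _≋_ _≐ᵀ_ _∼_
    _≋_ : Trace A → Trace A → Set
    _≋_ = _≈_ A
    _≐ᵀ_ : Team A → Team A → Set
    _≐ᵀ_ = _≐_ A
    _∼_ : Team A → Team A → Set
    _∼_ = _≡st_ A
    _⟦_⟧ : Team A → (ℕ → ℕ) → Team A
    _⟦_⟧ = _[_] A

  infix 4 _≲_
  _≲_ : Team A → Team A → Set
  T ≲ U = ∀ t → T t → ∃[ u ] (U u × t ≋ u)

  ≲-trans : ∀ {T U V} → T ≲ U → U ≲ V → T ≲ V
  ≲-trans T≲U U≲V t Tt with T≲U t Tt
  ... | u , Uu , t≋u with U≲V u Uu
  ... | v , Vv , u≋v = v , Vv , λ n → trans (t≋u n) (u≋v n)

  ≐-refl : ∀ {T} → T ≐ᵀ T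
  ≐-refl = (λ t Tt → t , Tt , λ _ → refl) , (λ t Tt → t , Tt , λ _ → refl)

  ≐-sym : ∀ {T U} → T ≐ᵀ U → U ≐ᵀ T
  ≐-sym (T≲U , U≲T) = U≲T , T≲U

  ≐-trans : ∀ {T U V} → T ≐ᵀ U → U ≐ᵀ V → T ≐ᵀ V
  ≐-trans (T≲U , U≲T) (U≲V , V≲U) = ≲-trans T≲U U≲V , ≲-trans V≲U U≲T

  []-mono : ∀ {T U} f → T ≲ U → T ⟦ f ⟧ ≲ U ⟦ f ⟧
  []-mono f T≲U u (t , Tt , u≋t∘f) with T≲U t Tt
  ... | s , Us , t≋s = s ∘ f , (s , Us , λ _ → refl) , λ n → trans (u≋t∘f n) (t≋s (f n))

  []-cong : ∀ {T U} f → T ≐ᵀ U → T ⟦ f ⟧ ≐ᵀ U ⟦ f ⟧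
  []-cong f (T≲U , U≲T) = []-mono f T≲U , []-mono f U≲T

  []-id : ∀ T → T ≐ᵀ T ⟦ id ⟧
  []-id T = (λ t Tt → t , (t , Tt , λ _ → refl) , λ _ → refl)
          , (λ u (t , Tt , u≋t) → t , Tt , u≋t)

  []-∘ : ∀ T f g → T ⟦ f ∘ g ⟧ ≐ᵀ T ⟦ f ⟧ ⟦ g ⟧
  []-∘ T f g =
      (λ u (t , Tt , u≋t∘f∘g) → u , (t ∘ f , (t , Tt , λ _ → refl) , u≋t∘f∘g) , λ _ → refl)
    , (λ u (_ , (t , Tt , v≋t∘f) , u≋v∘g) →
         u , (t , Tt , λ n → trans (u≋v∘g n) (v≋t∘f (g n))) , λ _ → refl)

  []-pointwise : ∀ {T f g} → (∀ t → T t → ∀ n → t (f n) ≡ t (g n)) → T ⟦ f ⟧ ≐ᵀ T ⟦ g ⟧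
  []-pointwise {T} same = half same , half (λ t Tt n → sym (same t Tt n))
    where
    half : ∀ {f g} → (∀ t → T t → ∀ n → t (f n) ≡ t (g n)) → T ⟦ f ⟧ ≲ T ⟦ g ⟧
    half {g = g} same u (t , Tt , u≋t∘f) =
      t ∘ g , (t , Tt , λ _ → refl) , λ n → trans (u≋t∘f n) (same t Tt n)

  stutterFree-resp : ∀ {T U} → T ≐ᵀ U → StutterFree A T → StutterFree A U
  stutterFree-resp {T} (T≲U , U≲T) sfT i (stallU , u , j , Uu , 1+i<j , ui≢uj) with U≲T u Uu
  ... | t , Tt , u≋t =
    sfT i (stallT , t , j , Tt , 1+i<j ,
           λ ti≡tj → ui≢uj (trans (u≋t i) (trans ti≡tj (sym (u≋t j)))))
    where
    stallT : ∀ s → T s → s i ≡ s (suc i)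
    stallT s Ts with T≲U s Ts
    ... | v , Uv , s≋v = trans (s≋v i) (trans (stallU v Uv) (sym (s≋v (suc i))))

  stuttering-resp : ∀ {t u f} → u ≋ t → IsStutteringFunction A t f → IsStutteringFunction A u f
  stuttering-resp u≋t (f-inc , f0≡0 , f-block) =
    f-inc , f0≡0 , λ k i lo hi → trans (u≋t i) (trans (f-block k i lo hi) (sym (u≋t _)))

  teamStuttering-antitone : ∀ {T U f} → U ≲ T →
    IsTeamStutteringFunction A T f → IsTeamStutteringFunction A U f
  teamStuttering-antitone U≲T hf u Uu with U≲T u Uu
  ... | t , Tt , u≋t = stuttering-resp u≋t (hf t Tt)

  id-stuttering : ∀ T → IsTeamStutteringFunction A T id
  id-stuttering T t _ =
    (λ _ _ m<n → m<n) , refl , λ k i k≤i i<1+k → cong t (≤-antisym (m<1+n⇒m≤n i<1+k) k≤i)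

  ∘-stuttering : ∀ {t f g} → IsStutteringFunction A t f → IsStutteringFunction A (t ∘ f) g →
    IsStutteringFunction A t (f ∘ g)
  ∘-stuttering {t} {f} {g} (f-inc , f0≡0 , f-block) (g-inc , g0≡0 , g-block) =
    (λ m n m<n → f-inc _ _ (g-inc m n m<n)) , trans (cong f g0≡0) f0≡0 , fg-block
    where
    fg-block : ∀ k i → f (g k) ≤ i → i < f (g (suc k)) → t i ≡ t (f (g k))
    fg-block k i lo hi with inc-block f-inc f0≡0 i
    ... | j , fj≤i , i<fj+1 =
      trans (f-block j i fj≤i i<fj+1)
            (g-block k j (m<1+n⇒m≤n (inc-cancel-< f-inc (≤-<-trans lo i<fj+1)))
                         (inc-cancel-< f-inc (≤-<-trans fj≤i hi)))

  ∘-teamStuttering : ∀ {T f g} → IsTeamStutteringFunction A T f →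
    IsTeamStutteringFunction A (T ⟦ f ⟧) g → IsTeamStutteringFunction A T (f ∘ g)
  ∘-teamStuttering hf hg t Tt = ∘-stuttering (hf t Tt) (hg _ (t , Tt , λ _ → refl))

  ≡st-refl : ∀ T → T ∼ T
  ≡st-refl T = id , id , id-stuttering T , id-stuttering T , ≐-refl

  ≡st-sym : ∀ {T U} → T ∼ U → U ∼ T
  ≡st-sym (f , g , hf , hg , e) = g , f , hg , hf , ≐-sym e

  ConstantFrom : Team A → ℕ → Set
  ConstantFrom T p = ∀ t → T t → ∀ i → p ≤ i → t i ≡ t p

  -- Up to their first divergence a and b agree; after it every trace is constant.
  divergence-constant⇒[]-≐ : ∀ {W a b} →
    IsTeamStutteringFunction A W a → IsTeamStutteringFunction A W b →
    (∀ m → a m ≡ b m → a (suc m) ≢ b (suc m) → ConstantFrom W (a m)) →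
    W ⟦ a ⟧ ≐ᵀ W ⟦ b ⟧
  divergence-constant⇒[]-≐ {W} {a} {b} ha hb diverge = []-pointwise same
    where
    agree : a 0 ≡ b 0 → ∀ m → a m ≡ b m ⊎ ∃[ k ] (k ≤ m × a k ≡ b k × ConstantFrom W (a k))
    agree a0≡b0 zero = inj₁ a0≡b0
    agree a0≡b0 (suc m) with agree a0≡b0 m
    ... | inj₂ (k , k≤m , ak≡bk , const) = inj₂ (k , m≤n⇒m≤1+n k≤m , ak≡bk , const)
    ... | inj₁ am≡bm with a (suc m) ≟ b (suc m)
    ...   | yes eq = inj₁ eq
    ...   | no neq = inj₂ (m , n≤1+n m , am≡bm , diverge m am≡bm neq)

    same : ∀ t → W t → ∀ m → t (a m) ≡ t (b m)
    same t Wt m with ha t Wt | hb t Wt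
    ... | a-inc , a0≡0 , _ | b-inc , b0≡0 , _ with agree (trans a0≡0 (sym b0≡0)) m
    ...   | inj₁ am≡bm = cong t am≡bm
    ...   | inj₂ (k , k≤m , ak≡bk , const) =
      trans (const t Wt (a m) (inc-mono-≤ a-inc k≤m))
            (sym (const t Wt (b m) (subst (_≤ b m) (sym ak≡bk) (inc-mono-≤ b-inc k≤m))))

  module _ (em : ExcludedMiddle 0ℓ) where

    ∃-least : ∀ {P : ℕ → Set} {n} → P n → ∃[ m ] (P m × ∀ i → i < m → ¬ P i)
    ∃-least {P} {n} Pn with search (suc n)
      where
      search : ∀ N → ∃[ m ] (P m × ∀ i → i < m → ¬ P i) ⊎ (∀ i → i < N → ¬ P i)
      search zero = inj₂ (λ _ ())
      search (suc N) with search N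
      ... | inj₁ least = inj₁ least
      ... | inj₂ none with em {P N}
      ...   | yes PN = inj₁ (N , PN , none)
      ...   | no ¬PN = inj₂ λ i i<1+N → case (m≤n⇒m<n∨m≡n (m<1+n⇒m≤n i<1+N))
        where
        case : ∀ {i} → i < N ⊎ i ≡ N → ¬ P i
        case (inj₁ i<N) = none _ i<N
        case (inj₂ refl) = ¬PN
    ... | inj₁ least = least
    ... | inj₂ none  = ⊥-elim (none n ≤-refl Pn)

    stall⇒constantFrom : ∀ {T i} → StutterFree A T → (∀ t → T t → t i ≡ t (suc i)) →
      ConstantFrom T i
    stall⇒constantFrom sf stall t Tt j i≤j with m≤n⇒m<n∨m≡n i≤j
    ... | inj₂ refl = refl
    ... | inj₁ i<j with m≤n⇒m<n∨m≡n i<j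
    ...   | inj₂ refl = sym (stall t Tt)
    ...   | inj₁ 1+i<j with em {t j ≡ t _}
    ...     | yes tj≡ti = tj≡ti
    ...     | no tj≢ti = ⊥-elim (sf _ (stall , t , j , Tt , 1+i<j , tj≢ti ∘ sym))

    divergence⇒constantFrom : ∀ {W a b m} →
      IsTeamStutteringFunction A W a → IsTeamStutteringFunction A W b →
      StutterFree A (W ⟦ a ⟧) → a m ≡ b m → a (suc m) < b (suc m) → ConstantFrom W (a m)
    divergence⇒constantFrom {W} {a} {b} {m} ha hb sf am≡bm a<b t Wt i am≤i
      with ha t Wt
    ... | a-inc , a0≡0 , a-block with inc-block a-inc a0≡0 i
    ...   | j , aj≤i , i<aj+1 =
      trans (a-block j i aj≤i i<aj+1)
            (constant (t ∘ a) (t , Wt , λ _ → refl) j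
                      (m<1+n⇒m≤n (inc-cancel-< a-inc (≤-<-trans am≤i i<aj+1))))
      where
      stallW : ∀ s → W s → s (a m) ≡ s (a (suc m))
      stallW s Ws with ha s Ws | hb s Ws
      ... | a-inc , _ | _ , _ , b-block =
        trans (cong s am≡bm)
              (sym (b-block m (a (suc m))
                            (subst (_≤ a (suc m)) am≡bm (<⇒≤ (a-inc m (suc m) (n<1+n m))))
                            a<b))

      constant : ConstantFrom (W ⟦ a ⟧) m
      constant = stall⇒constantFrom sf λ u (s , Ws , u≋s∘a) →
        trans (u≋s∘a m) (trans (stallW s Ws) (sym (u≋s∘a (suc m))))

    reducts-unique : ∀ {W a b} →
      IsTeamStutteringFunction A W a → IsTeamStutteringFunction A W b →
      StutterFree A (W ⟦ a ⟧) → StutterFree A (W ⟦ b ⟧) → W ⟦ a ⟧ ≐ᵀ W ⟦ b ⟧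
    reducts-unique {W} {a} {b} ha hb sfa sfb = divergence-constant⇒[]-≐ ha hb diverge
      where
      diverge : ∀ m → a m ≡ b m → a (suc m) ≢ b (suc m) → ConstantFrom W (a m)
      diverge m am≡bm neq with <-cmp (a (suc m)) (b (suc m))
      ... | tri< a<b _ _ = divergence⇒constantFrom ha hb sfa am≡bm a<b
      ... | tri≈ _ eq _  = ⊥-elim (neq eq)
      ... | tri> _ _ b<a =
        subst (ConstantFrom W) (sym am≡bm) (divergence⇒constantFrom hb ha sfb (sym am≡bm) b<a)

    stutterFree⇒[]-fixed : ∀ {T f} → StutterFree A T → IsTeamStutteringFunction A T f →
      T ≐ᵀ T ⟦ f ⟧
    stutterFree⇒[]-fixed {T} {f} sf hf =
      ≐-trans ([]-id T) (divergence-constant⇒[]-≐ (id-stuttering T) hf diverge)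
      where
      diverge : ∀ m → m ≡ f m → suc m ≢ f (suc m) → ConstantFrom T m
      diverge m m≡fm neq t Tt =
        divergence⇒constantFrom (id-stuttering T) hf (stutterFree-resp ([]-id T) sf) m≡fm
          (≤∧≢⇒< (inc-inflationary (proj₁ (hf t Tt)) (suc m)) neq) t Tt

    module CanonicalReduct (X : Team A) where

      ChangeAfter : ℕ → ℕ → Set
      ChangeAfter p j = p < j × ∃[ t ] (X t × t j ≢ t p)

      record NextBlock (p : ℕ) : Set where
        field
          end : ℕ
          p<end : p < end
          constant : ∀ t → X t → ∀ i → p ≤ i → i < end → t i ≡ t p
          change⊎final : ChangeAfter p end ⊎ (∀ j → ¬ ChangeAfter p j)

      next : ∀ p → NextBlock p
      next p with em {∃[ j ] ChangeAfter p j}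
      ... | no none = record
        { end = suc p
        ; p<end = n<1+n p
        ; constant = λ t _ i p≤i i<1+p → cong t (≤-antisym (m<1+n⇒m≤n i<1+p) p≤i)
        ; change⊎final = inj₂ λ j change → none (j , change)
        }
      ... | yes (_ , change) with ∃-least {ChangeAfter p} change
      ...   | q , change@(p<q , _) , minimal = record
        { end = q
        ; p<end = p<q
        ; constant = constant
        ; change⊎final = inj₁ change
        }
        where
        constant : ∀ t → X t → ∀ i → p ≤ i → i < q → t i ≡ t p
        constant t Xt i p≤i i<q with m≤n⇒m<n∨m≡n p≤i
        ... | inj₂ refl = refl
        ... | inj₁ p<i with em {t i ≡ t p}
        ...   | yes ti≡tp = ti≡tp
        ...   | no ti≢tp = ⊥-elim (minimal i i<q (p<i , t , Xt , ti≢tp))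

      c : ℕ → ℕ
      c zero    = 0
      c (suc k) = NextBlock.end (next (c k))

      c-inc : ∀ m n → m < n → c m < c n
      c-inc = inc-by-steps (λ k → NextBlock.p<end (next (c k)))

      c-stuttering : IsTeamStutteringFunction A X c
      c-stuttering t Xt = c-inc , refl , λ k → NextBlock.constant (next (c k)) t Xt

      c-stutterFree : StutterFree A (X ⟦ c ⟧)
      c-stutterFree k (stall , u , j , (t , Xt , u≋t∘c) , 1+k<j , uk≢uj)
        with NextBlock.change⊎final (next (c k))
      ... | inj₁ (_ , s , Xs , changes) = changes (sym (stall (s ∘ c) (s , Xs , λ _ → refl)))
      ... | inj₂ final = final (c j)
        (c-inc k j (<⇒≤ 1+k<j) , t , Xt ,
         λ tcj≡tck → uk≢uj (trans (u≋t∘c k) (trans (sym tcj≡tck) (sym (u≋t∘c j)))))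

    stutterFree-representative : ∀ T → ∃[ S ] (StutterFree A S × S ∼ T)
    stutterFree-representative T =
      T ⟦ c ⟧ , c-stutterFree ,
      id , c , id-stuttering _ , c-stuttering , ≐-sym ([]-id (T ⟦ c ⟧))
      where open CanonicalReduct T

    common-stutterFree-reduct : ∀ {T U} → T ∼ U →
      ∃[ f ] ∃[ g ] (IsTeamStutteringFunction A T f × IsTeamStutteringFunction A U g
                     × StutterFree A (T ⟦ f ⟧) × T ⟦ f ⟧ ≐ᵀ U ⟦ g ⟧)
    common-stutterFree-reduct {T} {U} (f , g , hf , hg , e) =
      f ∘ c , g ∘ c ,
      ∘-teamStuttering hf c-stuttering ,
      ∘-teamStuttering hg (teamStuttering-antitone (proj₂ e) c-stuttering) ,
      stutterFree-resp (≐-sym ([]-∘ T f c)) c-stutterFree ,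
      ≐-trans ([]-∘ T f c) (≐-trans ([]-cong c e) (≐-sym ([]-∘ U g c)))
      where open CanonicalReduct (T ⟦ f ⟧)

    ≡st-trans : ∀ {T U V} → T ∼ U → U ∼ V → T ∼ V
    ≡st-trans T∼U U∼V with common-stutterFree-reduct T∼U | common-stutterFree-reduct U∼V
    ... | f , g , hf , hg , sfT , e₁ | g₂ , h , hg₂ , hh , sfU , e₂ =
      f , h , hf , hh ,
      ≐-trans e₁ (≐-trans (reducts-unique hg hg₂ (stutterFree-resp e₁ sfT) sfU) e₂)

    stutterFree-≡st⇒≐ : ∀ {S S₂} → StutterFree A S → StutterFree A S₂ → S ∼ S₂ → S ≐ᵀ S₂
    stutterFree-≡st⇒≐ sf sf₂ (_ , _ , hf , hg , e) =
      ≐-trans (stutterFree⇒[]-fixed sf hf) (≐-trans e (≐-sym (stutterFree⇒[]-fixed sf₂ hg)))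

    stutterFree-representative-unique : ∀ {T S S₂} → StutterFree A S → StutterFree A S₂ →
      S ∼ T → S₂ ∼ T → S ≐ᵀ S₂
    stutterFree-representative-unique sf sf₂ S∼T S₂∼T =
      stutterFree-≡st⇒≐ sf sf₂ (≡st-trans S∼T (≡st-sym S₂∼T))

theorem23 : ExcludedMiddle 0ℓ → (A : Set) →
    -- (1)
    (∀ (T : Team A) → StutterFree A T →
       ∀ (f : ℕ → ℕ) → IsTeamStutteringFunction A T f → _≐_ A T (_[_] A T f))
    -- (2)
    × (∀ (T : Team A) →
         ∃[ S ] (StutterFree A S × _≡st_ A S T
                 × (∀ (S' : Team A) → StutterFree A S' → _≡st_ A S' T → _≐_ A S' S)))
    -- (3)
    × ((∀ (T : Team A) → _≡st_ A T T)
       × (∀ (T U : Team A) → _≡st_ A T U → _≡st_ A U T)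
       × (∀ (T U V : Team A) → _≡st_ A T U → _≡st_ A U V → _≡st_ A T V))
    -- (4)
    × (∀ (T : Team A) →
         ∃[ S ] (_≡st_ A S T × StutterFree A S)
         × (∀ (S S' : Team A) → _≡st_ A S T → StutterFree A S →
              _≡st_ A S' T → StutterFree A S' → _≐_ A S S'))
theorem23 em A =
    (λ _ sf _ hf → stutterFree⇒[]-fixed A em sf hf)
  , (λ T → let S , sfS , S∼T = stutterFree-representative A em T in
       S , sfS , S∼T ,
       λ _ sf₂ S₂∼T → stutterFree-representative-unique A em sf₂ sfS S₂∼T S∼T)
  , (≡st-refl A , (λ _ _ → ≡st-sym A) , λ _ _ _ → ≡st-trans A em)
  , (λ T → let S , sfS , S∼T = stutterFree-representative A em T in
       S , (S∼T , sfS) ,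
       λ _ _ S∼T sf S₂∼T sf₂ → stutterFree-representative-unique A em sf sf₂ S∼T S₂∼T)
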